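{- Let $a_1,\dots,a_n$ be nonzero integers, consider the equation $a_1x_1+\cdots+a_nx_n=0$, and let $A_{j,1}x_1+\cdots+A_{j,n}x_n\neq 0$ ($1\le j\le k$, $A_{j,i}\in\mathbb{Z}$) be finitely many inequalities, none of whose coefficient vectors $(A_{j,1},\dots,A_{j,n})$ is a scalar multiple of $(a_1,\dots,a_n)$. For $1\le l\le n$ let $$S_l=-\frac{\left(\sum_{i=1}^n a_i\right)-a_l}{a_l}.$$ Suppose there is an upper triangular $m\times m$ matrix $(c_{i,j})$ (so $c_{i,j}=0$ for $i>j$) such that every entry $c_{i,j}$ with $1\le i\le j\le m$ is positive and equals $S_l$ for some $l\in\{1,\dots,n\}$, and which has the linkage property: for each $1\le i\le m-1$ and each $j$ with $i<j\le m$, $c_{1,i}\,c_{i+1,j}=c_{1,j}$. Then the equation is strongly $m$-regular; in particular, the system of the equation and the given inequalities is $m$-regular.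
   Context: A system consisting of an equation $a_1x_1+\cdots+a_nx_n=0$ (with $a_i$ nonzero integers) and finitely many inequalities with integer coefficients is called $r$-regular if for every coloring of the positive integers with $r$ colors there exist positive integers $x_1,\dots,x_n$, all of the same color, satisfying the equation and all the inequalities (with no inequalities, this defines $r$-regularity of the equation). The equation is called strongly $r$-regular if for every finite collection of inequalities $A_{j,1}x_1+\cdots+A_{j,n}x_n\neq 0$ with integer coefficients, none of whose coefficient vectors is a scalar multiple of $(a_1,\dots,a_n)$, the system of the equation and these inequalities is $r$-regular. -}

module Defs where

open import Data.Nat as ℕ using (ℕ; zero; suc; _≤_)
open import Data.Fin using (Fin; zero; suc)
open import Data.Integer as ℤ using (ℤ; +_; 0ℤ)
open import Data.Rational as ℚ using (ℚ; 0ℚ; _/_; ↥_; _÷_)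
open import Data.Rational.Properties using (↥-/)
open import Data.Product using (Σ; _×_)
open import Relation.Nullary using (¬_)
open import Relation.Binary.PropositionalEquality using (_≡_; _≢_; refl; sym; trans; cong)
open import Data.Integer.Properties using (*-zeroˡ)
open import Data.Integer.GCD using (gcd)

sumℤ : ∀ {n} → (Fin n → ℤ) → ℤ
sumℤ {zero}  f = 0ℤ
sumℤ {suc n} f = f zero ℤ.+ sumℤ (λ i → f (suc i))

lin : ∀ {n} → (Fin n → ℤ) → (Fin n → ℕ) → ℤ
lin a x = sumℤ (λ i → a i ℤ.* + x i)

toℚ : ℤ → ℚ
toℚ z = z / 1

toℚ-≢0 : ∀ {z} → z ≢ 0ℤ → toℚ z ≢ 0ℚ
toℚ-≢0 {z} z≢0 eq = z≢0 (trans (sym (↥-/ z 1)) lem)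
  where
  lem : ↥ (z / 1) ℤ.* gcd z (+ 1) ≡ 0ℤ
  lem rewrite eq = *-zeroˡ (gcd z (+ 1))

S : ∀ {n} (a : Fin n → ℤ) → (∀ i → a i ≢ 0ℤ) → Fin n → ℚ
S a nz l = ℚ.- ((toℚ (sumℤ a ℤ.- a l) ÷ toℚ (a l)) {{ℚ.≢-nonZero (toℚ-≢0 (nz l))}})

ScalarMultiple : ∀ {n} → (Fin n → ℤ) → (Fin n → ℤ) → Set
ScalarMultiple v a = Σ ℚ (λ t → ∀ i → toℚ (v i) ≡ t ℚ.* toℚ (a i))

Regular : ∀ {n k} → ℕ → (Fin n → ℤ) → (Fin k → Fin n → ℤ) → Set
Regular {n} {k} r a A =
  (χ : ℕ → Fin r) →
  Σ (Fin n → ℕ) (λ x →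
      (∀ i → 1 ≤ x i)
    × (∀ i j → χ (x i) ≡ χ (x j))
    × (lin a x ≡ 0ℤ)
    × (∀ j → lin (A j) x ≢ 0ℤ))

StronglyRegular : ∀ {n} → ℕ → (Fin n → ℤ) → Set
StronglyRegular {n} r a =
  (k : ℕ) (A : Fin k → Fin n → ℤ) →
  (∀ j → ¬ ScalarMultiple (A j) a) → Regular r a A

module Submission where

-- Put q 0 = 1 and q t = c 1 t.  By the linkage property every ratio q j / q i
-- (i < j) is one of the S l; clearing denominators gives positive integers
-- e 0, …, e m with the same ratios.  Given an m-colouring χ, colour v by the
-- tuple (χ (e t · v))ₜ; van der Waerden's theorem yields a long progression
-- a₀ + 1 + o · d on which all these tuples agree.  Two of the m + 1 numbers
-- e t · (a₀ + 1) share a colour, say those with weights eᵢ, eⱼ, eⱼ / eᵢ = S l.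
-- The weight vector (eᵢ, …, eⱼ at l, …, eᵢ) is orthogonal to a, so
-- x r = weight r · (Z + u r · d) solves the equation for every integer vector
-- u with a · u = 0 and u l = 0, and x is monochromatic when each Z + u r · d
-- lies on the progression.  Such a u is chosen to detect every inequality it
-- can (a row invisible to this lattice and balanced against the weights is a
-- multiple of a, hence excluded), and then Z among k + 1 values so that no
-- inequality vanishes.

-- Van der Waerden's theorem, by the classical "focusing" induction.
module VanDerWaerden where

  open import Data.Nat
  open import Data.Nat.Properties
  open import Data.Nat.Tactic.RingSolver using (solve-∀)
  open import Data.Fin as F using (Fin; zero; suc; toℕ; fromℕ<; combine)
  open import Data.Fin.Properties using (combine-injective; pigeonhole; any?; toℕ-fromℕ<)
    renaming (_≟_ to _≟F_)
  open import Data.Product using (Σ; _×_; _,_; proj₁; proj₂)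
  open import Data.Sum using (_⊎_; inj₁; inj₂)
  open import Data.Empty using (⊥-elim)
  open import Relation.Nullary using (yes; no)
  open import Relation.Binary.PropositionalEquality

  encode : ∀ {r} N → (Fin N → Fin r) → Fin (r ^ N)
  encode zero    f = zero
  encode (suc N) f = combine (f zero) (encode N (λ i → f (suc i)))

  encode-injective : ∀ {r} N (f g : Fin N → Fin r) → encode N f ≡ encode N g → ∀ i → f i ≡ g i
  encode-injective {r} (suc N) f g eq i with combine-injective {r} {r ^ N} (f zero) _ (g zero) _ eq
  encode-injective (suc N) f g eq zero    | head≡ , tail≡ = head≡
  encode-injective (suc N) f g eq (suc i) | head≡ , tail≡ =
    encode-injective N (λ i → f (suc i)) (λ i → g (suc i)) tail≡ i

  MonoAP : ∀ {r} → (ℕ → Fin r) → ℕ → ℕ → Set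
  MonoAP χ k N = Σ ℕ λ a → Σ ℕ λ d → (1 ≤ d) × (d < N) × (a + k * d < N)
    × (∀ j → j ≤ k → χ (a + j * d) ≡ χ a)

  -- Van der Waerden's theorem for progressions with k + 1 terms.
  VdW : ℕ → Set
  VdW k = ∀ r → Σ ℕ λ N → ∀ (χ : ℕ → Fin r) → MonoAP χ k N

  -- s progressions with k + 1 terms each, monochromatic, of pairwise distinct
  -- colours, all of whose next terms a i + (k + 1)·d i coincide in a "focus" f < N.
  Focused : ∀ {r} → (ℕ → Fin r) → ℕ → ℕ → ℕ → Set
  Focused χ k s N = Σ ℕ λ f → f < N × Σ (Fin s → ℕ) λ a → Σ (Fin s → ℕ) λ d →
    (∀ i → 1 ≤ d i) × (∀ i → a i + suc k * d i ≡ f)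
    × (∀ i j → j ≤ k → χ (a i + j * d i) ≡ χ (a i))
    × (∀ i i′ → χ (a i) ≡ χ (a i′) → i ≡ i′)

  Focusing : ℕ → ℕ → ℕ → Set
  Focusing k r s = Σ ℕ λ N → ∀ (χ : ℕ → Fin r) → MonoAP χ (suc k) N ⊎ Focused χ k s N

  extendAP : ∀ {r} (χ : ℕ → Fin r) k N a d f → 1 ≤ d → a + suc k * d ≡ f → f < N →
    (∀ j → j ≤ k → χ (a + j * d) ≡ χ a) → χ f ≡ χ a → MonoAP χ (suc k) N
  extendAP χ k N a d f 1≤d last≡f f<N mono χf≡χa =
    a , d , 1≤d , d<N , subst (_< N) (sym last≡f) f<N , mono′
    where
    d<N : d < N
    d<N = ≤-<-trans (subst (d ≤_) last≡f (≤-trans (m≤m+n d (k * d)) (m≤n+m (suc k * d) a))) f<N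
    mono′ : ∀ j → j ≤ suc k → χ (a + j * d) ≡ χ a
    mono′ j j≤ with m≤n⇒m<n∨m≡n j≤
    ... | inj₁ (s≤s j≤k) = mono j j≤k
    ... | inj₂ refl      = trans (cong χ last≡f) χf≡χa

  shiftAP : ∀ {r} (χ : ℕ → Fin r) k M N c → c + M ≤ N → M ≤ N →
    MonoAP (λ x → χ (c + x)) k M → MonoAP χ k N
  shiftAP χ k M N c c+M≤N M≤N (a , d , 1≤d , d<M , last<M , mono) =
    c + a , d , 1≤d , <-≤-trans d<M M≤N ,
    subst (_< N) (sym (+-assoc c a (k * d))) (<-≤-trans (+-monoʳ-< c last<M) c+M≤N) ,
    λ j j≤k → trans (cong χ (+-assoc c a (j * d))) (mono j j≤k)

  blockPattern : ∀ {r} (χ : ℕ → Fin r) M → ℕ → Fin (r ^ M)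
  blockPattern χ M b = encode M (λ i → χ (b * M + toℕ i))

  blockPattern-injective : ∀ {r} (χ : ℕ → Fin r) M b b′ →
    blockPattern χ M b ≡ blockPattern χ M b′ → ∀ x → x < M → χ (b * M + x) ≡ χ (b′ * M + x)
  blockPattern-injective χ M b b′ eq x x<M =
    subst (λ y → χ (b * M + y) ≡ χ (b′ * M + y)) (toℕ-fromℕ< x<M)
      (encode-injective M (λ i → χ (b * M + toℕ i)) (λ i → χ (b′ * M + toℕ i)) eq (fromℕ< x<M))

  focusing-zero : ∀ k r → Focusing k r 0
  focusing-zero k r = 1 , λ χ → inj₂ (0 , s≤s z≤n , (λ ()) , (λ ()) , (λ ()) , (λ ()) , (λ ()) , λ ())

  block-< : ∀ x y f M → x < y → f < M → x * M + f < y * M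
  block-< x y f M x<y f<M = <-≤-trans (+-monoʳ-< (x * M) f<M)
    (subst (_≤ y * M) (+-comm M (x * M)) (*-monoˡ-≤ M x<y))

  progression-term-< : ∀ a j k d f M → j ≤ k → a + suc k * d ≡ f → f < M → a + j * d < M
  progression-term-< a j k d f M j≤k last≡f f<M =
    ≤-<-trans (+-monoʳ-≤ a (*-monoˡ-≤ d (m≤n⇒m≤1+n j≤k))) (subst (_< M) (sym last≡f) f<M)

  -- Blocks b, b + D, …, b + k·D of length M carry the same
  -- pattern; inside block b we have s focused progressions (for the colouring
  -- restricted to the block).  Either the focus extends one of them, or the
  -- progressions spread across the blocks, together with the progression of the
  -- focus itself, give s + 1 focused progressions inside [0, 2·W·M).
  module FocusStep {r} (k M W : ℕ) (χ : ℕ → Fin r) (b D : ℕ) (1≤D : 1 ≤ D) (D<W : D < W)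
    (last<W : b + k * D < W)
    (samePattern : ∀ j → j ≤ k → ∀ x → x < M → χ ((b + j * D) * M + x) ≡ χ (b * M + x)) where

    N : ℕ
    N = (2 * W) * M

    χb : ℕ → Fin r
    χb x = χ (b * M + x)

    bM+M≤N : b * M + M ≤ N
    bM+M≤N = subst (_≤ N) (+-comm M (b * M))
      (*-monoˡ-≤ M (≤-trans (≤-trans (s≤s (m≤m+n b (k * D))) last<W) (m≤m+n W (1 * W))))

    shift : ∀ {k′} → MonoAP χb k′ M → MonoAP χ k′ N
    shift = shiftAP χ _ M N (b * M) bM+M≤N (≤-trans (m≤n+m M (b * M)) bM+M≤N)

    step : ∀ {s} → Focused χb k s M → MonoAP χ (suc k) N ⊎ Focused χ k (suc s) N
    step {s} (f , f<M , a , d , 1≤d , last≡f , mono , distinct)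
      with any? (λ i → χb f ≟F χb (a i))
    ... | yes (i , χf≡) = inj₁ (shift (extendAP χb k M (a i) (d i) f (1≤d i) (last≡f i) f<M (mono i) χf≡))
    ... | no χf≢ = inj₂ (F , F<N , a′ , d′ , 1≤d′ , last≡F , mono′ , distinct′)
      where
      F : ℕ
      F = (b * M + f) + suc k * (D * M)
      focus-block : ∀ b M f k D → (b * M + f) + suc k * (D * M) ≡ ((b + k * D) + D) * M + f
      focus-block = solve-∀
      F<N : F < N
      F<N = subst (_< N) (sym (focus-block b M f k D))
        (block-< ((b + k * D) + D) (2 * W) f M
          (subst ((b + k * D) + D <_) (cong (W +_) (sym (+-identityʳ W))) (+-mono-< last<W D<W)) f<M)
      a′ d′ : Fin (suc s) → ℕ
      a′ zero    = b * M + f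
      a′ (suc i) = b * M + a i
      d′ zero    = D * M
      d′ (suc i) = d i + D * M
      1≤d′ : ∀ i → 1 ≤ d′ i
      1≤d′ zero    = ≤-trans 1≤D (subst (_≤ D * M) (*-identityʳ D) (*-monoʳ-≤ D (≤-trans (s≤s z≤n) f<M)))
      1≤d′ (suc i) = ≤-trans (1≤d i) (m≤m+n (d i) (D * M))
      spread-last : ∀ b M a k d D → (b * M + a) + suc k * (d + D * M) ≡ b * M + (a + suc k * d) + suc k * (D * M)
      spread-last = solve-∀
      last≡F : ∀ i → a′ i + suc k * d′ i ≡ F
      last≡F zero    = refl
      last≡F (suc i) = trans (spread-last b M (a i) k (d i) D) (cong (λ y → b * M + y + suc k * (D * M)) (last≡f i))
      focus-term : ∀ b M f j D → (b * M + f) + j * (D * M) ≡ (b + j * D) * M + f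
      focus-term = solve-∀
      spread-term : ∀ b M a j d D → (b * M + a) + j * (d + D * M) ≡ (b + j * D) * M + (a + j * d)
      spread-term = solve-∀
      mono′ : ∀ i j → j ≤ k → χ (a′ i + j * d′ i) ≡ χ (a′ i)
      mono′ zero j j≤k = trans (cong χ (focus-term b M f j D)) (samePattern j j≤k f f<M)
      mono′ (suc i) j j≤k = trans (cong χ (spread-term b M (a i) j (d i) D))
        (trans (samePattern j j≤k (a i + j * d i) (progression-term-< (a i) j k (d i) f M j≤k (last≡f i) f<M))
          (mono i j j≤k))
      distinct′ : ∀ i i′ → χ (a′ i) ≡ χ (a′ i′) → i ≡ i′
      distinct′ zero    zero     _ = refl
      distinct′ zero    (suc i′) e = ⊥-elim (χf≢ (i′ , e))
      distinct′ (suc i) zero     e = ⊥-elim (χf≢ (i , sym e))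
      distinct′ (suc i) (suc i′) e = cong suc (distinct i i′ e)

  -- Van der Waerden for k + 1 terms, applied to the colouring of blocks of length M
  -- by their patterns, lets one more focused progression be added.
  focusing-suc : ∀ k → VdW k → ∀ r s → Focusing k r s → Focusing k r (suc s)
  focusing-suc k vdw r s (M , focusing) = (2 * W) * M , go
    where
    W = proj₁ (vdw (r ^ M))
    go : ∀ χ → MonoAP χ (suc k) ((2 * W) * M) ⊎ Focused χ k (suc s) ((2 * W) * M)
    go χ with proj₂ (vdw (r ^ M)) (blockPattern χ M)
    ... | b , D , 1≤D , D<W , last<W , monoBlocks = result (focusing (λ x → χ (b * M + x)))
      where
      open FocusStep k M W χ b D 1≤D D<W last<W
        (λ j j≤k x x<M → blockPattern-injective χ M (b + j * D) b (monoBlocks j j≤k) x x<M)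
      result : MonoAP χb (suc k) M ⊎ Focused χb k s M → MonoAP χ (suc k) N ⊎ Focused χ k (suc s) N
      result (inj₁ ap)      = inj₁ (shift ap)
      result (inj₂ focused) = step focused

  focusing : ∀ k → VdW k → ∀ r s → Focusing k r s
  focusing k vdw r zero    = focusing-zero k r
  focusing k vdw r (suc s) = focusing-suc k vdw r s (focusing k vdw r s)

  -- With r + 1 focused progressions in r colours, the focus shares the colour of one.
  focusing⇒VdW : ∀ k r → Focusing k r r → Σ ℕ λ N → ∀ (χ : ℕ → Fin r) → MonoAP χ (suc k) N
  focusing⇒VdW k r (N , focused) = N , go
    where
    go : ∀ χ → MonoAP χ (suc k) N
    go χ with focused χ
    ... | inj₁ ap = ap
    ... | inj₂ (f , f<N , a , d , 1≤d , last≡f , mono , distinct) = collide (pigeonhole (n<1+n r) colour)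
      where
      colour : Fin (suc r) → Fin r
      colour zero    = χ f
      colour (suc i) = χ (a i)
      collide : (Σ (Fin (suc r)) λ i → Σ (Fin (suc r)) λ j → i F.< j × colour i ≡ colour j) → MonoAP χ (suc k) N
      collide (zero  , suc j , _   , e) = extendAP χ k N (a j) (d j) f (1≤d j) (last≡f j) f<N (mono j) e
      collide (suc i , suc j , i<j , e) with distinct i j e
      ... | refl = ⊥-elim (<-irrefl refl i<j)

  -- Two-term progressions are trivial; focusing with s = r adds a term.
  vanDerWaerden : ∀ k → VdW k
  vanDerWaerden zero    r = 2 , λ χ → 0 , 1 , ≤-refl , s≤s (s≤s z≤n) , s≤s z≤n , λ { zero z≤n → refl }
  vanDerWaerden (suc k) r = focusing⇒VdW k r (focusing k (vanDerWaerden k) r r)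

module Linear where

  open import Defs
  open import Data.Nat using (zero; suc)
  open import Data.Integer using (ℤ; 0ℤ; 1ℤ; _+_; _*_; -_; _-_)
  open import Data.Integer.Properties using (+-identityˡ; +-identityʳ; *-identityʳ; *-zeroʳ; *-distribˡ-+; neg-distribˡ-*)
  open import Data.Integer.Tactic.RingSolver using (solve-∀)
  open import Data.Fin using (Fin; zero; suc)
  open import Data.Empty using (⊥-elim)
  open import Relation.Binary.PropositionalEquality
  open ≡-Reasoning

  δ : ∀ {n} → Fin n → Fin n → ℤ
  δ zero    zero    = 1ℤ
  δ zero    (suc _) = 0ℤ
  δ (suc _) zero    = 0ℤ
  δ (suc r) (suc s) = δ r s

  δ-refl : ∀ {n} (r : Fin n) → δ r r ≡ 1ℤ
  δ-refl zero    = refl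
  δ-refl (suc r) = δ-refl r

  δ-≢ : ∀ {n} (r s : Fin n) → r ≢ s → δ r s ≡ 0ℤ
  δ-≢ zero    zero    r≢s = ⊥-elim (r≢s refl)
  δ-≢ zero    (suc s) r≢s = refl
  δ-≢ (suc r) zero    r≢s = refl
  δ-≢ (suc r) (suc s) r≢s = δ-≢ r s (λ e → r≢s (cong suc e))

  sum-cong : ∀ {n} {f g : Fin n → ℤ} → (∀ i → f i ≡ g i) → sumℤ f ≡ sumℤ g
  sum-cong {zero}  f≗g = refl
  sum-cong {suc n} f≗g = cong₂ _+_ (f≗g zero) (sum-cong (λ i → f≗g (suc i)))

  sum-+ : ∀ {n} (f g : Fin n → ℤ) → sumℤ (λ i → f i + g i) ≡ sumℤ f + sumℤ g
  sum-+ {zero}  f g = refl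
  sum-+ {suc n} f g =
    trans (cong ((f zero + g zero) +_) (sum-+ (λ i → f (suc i)) (λ i → g (suc i))))
          (interchange (f zero) (g zero) (sumℤ (λ i → f (suc i))) (sumℤ (λ i → g (suc i))))
    where
    interchange : ∀ a b c d → a + b + (c + d) ≡ a + c + (b + d)
    interchange = solve-∀

  sum-*ˡ : ∀ {n} (c : ℤ) (f : Fin n → ℤ) → sumℤ (λ i → c * f i) ≡ c * sumℤ f
  sum-*ˡ {zero}  c f = sym (*-zeroʳ c)
  sum-*ˡ {suc n} c f = trans (cong (c * f zero +_) (sum-*ˡ c (λ i → f (suc i))))
                             (sym (*-distribˡ-+ c (f zero) _))

  sum-zero : ∀ {n} → sumℤ {n} (λ _ → 0ℤ) ≡ 0ℤ
  sum-zero {zero}  = refl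
  sum-zero {suc n} = trans (+-identityˡ _) (sum-zero {n})

  sum-lincomb : ∀ {n} x y (f g : Fin n → ℤ) → sumℤ (λ r → x * f r - y * g r) ≡ x * sumℤ f - y * sumℤ g
  sum-lincomb x y f g = begin
    sumℤ (λ r → x * f r - y * g r)                    ≡⟨ sum-cong (λ r → cong (λ z → x * f r + z) (neg-distribˡ-* y (g r))) ⟩
    sumℤ (λ r → x * f r + (- y) * g r)                ≡⟨ sum-+ (λ r → x * f r) (λ r → (- y) * g r) ⟩
    sumℤ (λ r → x * f r) + sumℤ (λ r → (- y) * g r)  ≡⟨ cong₂ _+_ (sum-*ˡ x f) (sum-*ˡ (- y) g) ⟩
    x * sumℤ f + (- y) * sumℤ g                      ≡⟨ cong (λ z → x * sumℤ f + z) (sym (neg-distribˡ-* y (sumℤ g))) ⟩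
    x * sumℤ f - y * sumℤ g                          ∎

  sum-δ : ∀ {n} (v : Fin n → ℤ) (r : Fin n) → sumℤ (λ s → v s * δ r s) ≡ v r
  sum-δ {suc n} v zero =
    trans (cong₂ _+_ (*-identityʳ (v zero))
                     (trans (sum-cong (λ i → *-zeroʳ (v (suc i)))) (sum-zero {n})))
          (+-identityʳ (v zero))
  sum-δ {suc n} v (suc r) =
    trans (cong (_+ sumℤ (λ s → v (suc s) * δ r s)) (*-zeroʳ (v zero)))
          (trans (+-identityˡ _) (sum-δ (λ s → v (suc s)) r))

  dot : ∀ {n} → (Fin n → ℤ) → (Fin n → ℤ) → ℤ
  dot v w = sumℤ (λ s → v s * w s)

  dot-zeroʳ : ∀ {n} (v : Fin n → ℤ) → dot v (λ _ → 0ℤ) ≡ 0ℤ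
  dot-zeroʳ {n} v = trans (sum-cong (λ s → *-zeroʳ (v s))) (sum-zero {n})

  dot-affine : ∀ {n} (v u b : Fin n → ℤ) (t : ℤ) → dot v (λ s → u s + t * b s) ≡ dot v u + t * dot v b
  dot-affine v u b t =
    trans (sum-cong (λ s → distribute (v s) (u s) (b s) t))
          (trans (sum-+ (λ s → v s * u s) (λ s → t * (v s * b s)))
                 (cong (dot v u +_) (sum-*ˡ t (λ s → v s * b s))))
    where
    distribute : ∀ x y z w → x * (y + w * z) ≡ x * y + w * (x * z)
    distribute = solve-∀

  dot-lincomb : ∀ {n} x y (v w W : Fin n → ℤ) → dot (λ r → x * v r - y * w r) W ≡ x * dot v W - y * dot w W
  dot-lincomb x y v w W =
    trans (sum-cong (λ s → distribute x y (v s) (w s) (W s))) (sum-lincomb x y (λ s → v s * W s) (λ s → w s * W s))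
    where
    distribute : ∀ x y p q c → (x * p - y * q) * c ≡ x * (p * c) - y * (q * c)
    distribute = solve-∀

  -- The vector a r₀ · e r − a r · e r₀: orthogonal to a, and pairing with v
  -- measures the failure of  v r : v r₀ = a r : a r₀.
  cross : ∀ {n} (a : Fin n → ℤ) (r₀ r : Fin n) → Fin n → ℤ
  cross a r₀ r s = a r₀ * δ r s - a r * δ r₀ s

  dot-cross : ∀ {n} (a v : Fin n → ℤ) (r₀ r : Fin n) → dot v (cross a r₀ r) ≡ a r₀ * v r - a r * v r₀
  dot-cross a v r₀ r =
    trans (sum-cong (λ s → expand (v s) (a r₀) (δ r s) (a r) (δ r₀ s)))
    (trans (sum-+ (λ s → a r₀ * (v s * δ r s)) (λ s → (- a r) * (v s * δ r₀ s)))
    (cong₂ _+_ (trans (sum-*ˡ (a r₀) (λ s → v s * δ r s)) (cong (a r₀ *_) (sum-δ v r)))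
               (trans (sum-*ˡ (- a r) (λ s → v s * δ r₀ s))
                      (trans (cong (- a r *_) (sum-δ v r₀)) (neg-* (a r) (v r₀))))))
    where
    expand : ∀ x p q y w → x * (p * q - y * w) ≡ p * (x * q) + (- y) * (x * w)
    expand = solve-∀
    neg-* : ∀ x y → (- x) * y ≡ - (x * y)
    neg-* = solve-∀

  dot-a-cross : ∀ {n} (a : Fin n → ℤ) (r₀ r : Fin n) → dot a (cross a r₀ r) ≡ 0ℤ
  dot-a-cross a r₀ r = trans (dot-cross a a r₀ r) (antisym (a r₀) (a r))
    where
    antisym : ∀ x y → x * y - y * x ≡ 0ℤ
    antisym = solve-∀

  cross-vanishes : ∀ {n} (a : Fin n → ℤ) {r₀ r l : Fin n} → r ≢ l → r₀ ≢ l → cross a r₀ r l ≡ 0ℤ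
  cross-vanishes a {r₀} {r} {l} r≢l r₀≢l =
    trans (cong₂ (λ x y → a r₀ * x - a r * y) (δ-≢ r l r≢l) (δ-≢ r₀ l r₀≢l)) (kill (a r₀) (a r))
    where
    kill : ∀ x y → x * 0ℤ - y * 0ℤ ≡ 0ℤ
    kill = solve-∀

-- Choosing an integer outside the roots of finitely many affine maps.
module AffineRoots where

  open import Data.Nat as ℕ using (ℕ; zero; suc)
  open import Data.Nat.Properties using (≤-pred; n<1+n; <-irrefl)
  open import Data.Integer as ℤ using (ℤ; +_; 0ℤ; _+_; _*_)
  open import Data.Integer.Properties using (+-identityˡ; *-zeroˡ; *-cancelˡ-≡; +-injective; +-0-abelianGroup)
  open import Algebra.Bundles using (AbelianGroup)
  open import Algebra.Properties.Group (AbelianGroup.group +-0-abelianGroup) using (∙-cancelʳ)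
  open import Data.Fin as F using (Fin; zero; suc; toℕ)
  open import Data.Fin.Properties using (any?; all?; ¬∀⟶∃¬; pigeonhole; toℕ<n)
  open import Data.Product using (Σ; _×_; _,_; proj₁)
  open import Data.Sum using (_⊎_; inj₁; inj₂)
  open import Data.Empty using (⊥; ⊥-elim)
  open import Relation.Nullary using (Dec; yes; no; ¬?)
  open import Relation.Nullary.Decidable using (_⊎-dec_; _→-dec_)
  open import Relation.Binary.PropositionalEquality

  NonTrivial : ℤ → ℤ → Set
  NonTrivial P Q = P ≢ 0ℤ ⊎ Q ≢ 0ℤ

  nonTrivial? : ∀ P Q → Dec (NonTrivial P Q)
  nonTrivial? P Q = ¬? (P ℤ.≟ 0ℤ) ⊎-dec ¬? (Q ℤ.≟ 0ℤ)

  affine-root-unique : ∀ {P Q} t t′ → NonTrivial P Q → P * + t + Q ≡ 0ℤ → P * + t′ + Q ≡ 0ℤ → t ≡ t′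
  affine-root-unique {P} {Q} t t′ nt root root′ with P ℤ.≟ 0ℤ
  ... | no P≢0 = +-injective (*-cancelˡ-≡ P (+ t) (+ t′) (∙-cancelʳ Q _ _ (trans root (sym root′))))
    where instance _ = ℤ.≢-nonZero P≢0
  ... | yes refl with nt
  ...   | inj₁ P≢0 = ⊥-elim (P≢0 refl)
  ...   | inj₂ Q≢0 = ⊥-elim (Q≢0 (trans (sym (+-identityˡ Q)) (trans (cong (_+ Q) (sym (*-zeroˡ (+ t)))) root)))

  AvoidsRoots : ∀ {k} → (Fin k → ℤ) → (Fin k → ℤ) → ℕ → Set
  AvoidsRoots P Q t = ∀ j → NonTrivial (P j) (Q j) → P j * + t + Q j ≢ 0ℤ

  avoidsRootAt? : ∀ {k} (P Q : Fin k → ℤ) t j → Dec (NonTrivial (P j) (Q j) → P j * + t + Q j ≢ 0ℤ)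
  avoidsRootAt? P Q t j = nonTrivial? (P j) (Q j) →-dec ¬? (P j * + t + Q j ℤ.≟ 0ℤ)

  -- Among 0, 1, …, k some t avoids the roots of all k non-trivial affine maps:
  -- otherwise, by pigeonhole, one map would have two distinct roots.
  avoidRoots : ∀ k (P Q : Fin k → ℤ) → Σ ℕ λ t → t ℕ.≤ k × AvoidsRoots P Q t
  avoidRoots k P Q with any? (λ (t : Fin (suc k)) → all? (avoidsRootAt? P Q (toℕ t)))
  ... | yes (t , avoids) = toℕ t , ≤-pred (toℕ<n t) , avoids
  ... | no noneAvoids = ⊥-elim (twoRoots (pigeonhole (n<1+n k) (λ t → proj₁ (rootOf t))))
    where
    rootOf : ∀ (t : Fin (suc k)) → Σ (Fin k) λ j → NonTrivial (P j) (Q j) × P j * + toℕ t + Q j ≡ 0ℤ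
    rootOf t with ¬∀⟶∃¬ k _ (avoidsRootAt? P Q (toℕ t)) (λ avoids → noneAvoids (t , avoids))
    ... | j , fails with nonTrivial? (P j) (Q j) | P j * + toℕ t + Q j ℤ.≟ 0ℤ
    ...   | yes nt | yes root = j , nt , root
    ...   | yes nt | no ¬root = ⊥-elim (fails (λ _ → ¬root))
    ...   | no ¬nt | _       = ⊥-elim (fails (λ nt → ⊥-elim (¬nt nt)))
    twoRoots : (Σ (Fin (suc k)) λ t → Σ (Fin (suc k)) λ t′ → t F.< t′ × proj₁ (rootOf t) ≡ proj₁ (rootOf t′)) → ⊥
    twoRoots (t , t′ , t<t′ , same) with rootOf t | rootOf t′
    ... | j , nt , root | j′ , _ , root′ with same
    ...   | refl = <-irrefl (affine-root-unique (toℕ t) (toℕ t′) nt root root′) t<t′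

-- A lattice vector detecting every inequality that the lattice can detect.
module Lattice where

  open Linear
  open AffineRoots
  open import Data.Nat using (ℕ; zero; suc)
  open import Data.Integer as ℤ using (ℤ; +_; 0ℤ; _+_; _*_)
  open import Data.Integer.Properties using (+-identityˡ; +-identityʳ; *-zeroˡ; *-zeroʳ; *-comm; +-comm)
  open import Data.Fin using (Fin; zero; suc)
  open import Data.Fin.Properties using (any?) renaming (_≟_ to _≟F_)
  open import Data.Product using (Σ; _×_; _,_; proj₁; proj₂)
  open import Data.Sum using (inj₁; inj₂)
  open import Data.Empty using (⊥-elim)
  open import Relation.Nullary using (Dec; yes; no; ¬?)
  open import Relation.Nullary.Decidable using (_×-dec_)
  open import Relation.Binary.PropositionalEquality

  -- Fix a coordinate l and an auxiliary coordinate r₀ ≢ l.  The vectors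
  -- cross a r₀ r (r ≢ l) lie in the lattice  {u | a · u = 0, u l = 0}.
  module AuxiliaryVector {n} (a : Fin n → ℤ) (l r₀ : Fin n) (r₀≢l : r₀ ≢ l) where

    SeesLattice : (Fin n → ℤ) → Set
    SeesLattice v = Σ (Fin n) λ r → r ≢ l × dot v (cross a r₀ r) ≢ 0ℤ

    seesLattice? : ∀ v → Dec (SeesLattice v)
    seesLattice? v = any? (λ r → ¬? (r ≟F l) ×-dec ¬? (dot v (cross a r₀ r) ℤ.≟ 0ℤ))

    Avoiding : ∀ {k} → (Fin k → Fin n → ℤ) → (Fin n → ℤ) → Set
    Avoiding A u = dot a u ≡ 0ℤ × u l ≡ 0ℤ × (∀ j → SeesLattice (A j) → dot (A j) u ≢ 0ℤ)

    -- Such a u exists for every finite family: add the rows one at a time,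
    -- moving u along a lattice vector the new row sees, by a step t chosen
    -- so that no row that was non-orthogonal before becomes orthogonal.
    auxiliaryVector : ∀ k (A : Fin k → Fin n → ℤ) → Σ (Fin n → ℤ) (Avoiding A)
    auxiliaryVector zero A = (λ _ → 0ℤ) , dot-zeroʳ a , refl , λ ()
    auxiliaryVector (suc k) A with auxiliaryVector k (λ j → A (suc j)) | seesLattice? (A zero)
    ... | u , a·u≡0 , u-l≡0 , avoids | no ¬sees = u , a·u≡0 , u-l≡0 , avoids′
      where
      avoids′ : ∀ j → SeesLattice (A j) → dot (A j) u ≢ 0ℤ
      avoids′ zero    sees = ⊥-elim (¬sees sees)
      avoids′ (suc j) sees = avoids j sees
    ... | u , a·u≡0 , u-l≡0 , avoids | yes (r , r≢l , A₀·b≢0) = u′ , a·u′≡0 , u′-l≡0 , avoids′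
      where
      b : Fin n → ℤ
      b = cross a r₀ r
      P Q : Fin (suc k) → ℤ
      P j = dot (A j) b
      Q j = dot (A j) u
      step = avoidRoots (suc k) P Q
      t : ℕ
      t = proj₁ step
      u′ : Fin n → ℤ
      u′ s = u s + + t * b s
      dot-u′ : ∀ v → dot v u′ ≡ dot v b * + t + dot v u
      dot-u′ v = trans (dot-affine v u b (+ t))
                       (trans (+-comm (dot v u) _) (cong (_+ dot v u) (*-comm (+ t) (dot v b))))
      a·u′≡0 : dot a u′ ≡ 0ℤ
      a·u′≡0 = trans (dot-u′ a) (trans (cong₂ (λ x y → x * + t + y) (dot-a-cross a r₀ r) a·u≡0)
                               (trans (+-identityʳ _) (*-zeroˡ (+ t))))
      u′-l≡0 : u′ l ≡ 0ℤ
      u′-l≡0 = trans (cong₂ (λ x y → x + + t * y) u-l≡0 (cross-vanishes a r≢l r₀≢l))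
                     (trans (+-identityˡ _) (*-zeroʳ (+ t)))
      nonTrivial : ∀ j → SeesLattice (A j) → NonTrivial (P j) (Q j)
      nonTrivial zero    _    = inj₁ A₀·b≢0
      nonTrivial (suc j) sees = inj₂ (avoids j sees)
      avoids′ : ∀ j → SeesLattice (A j) → dot (A j) u′ ≢ 0ℤ
      avoids′ j sees A·u′≡0 = proj₂ (proj₂ step) j (nonTrivial j sees) (trans (sym (dot-u′ (A j))) A·u′≡0)

module Rationals where

  open import Defs
  open import Data.Nat as ℕ using (ℕ; zero; suc; z≤n; s≤s)
  import Data.Nat.Properties as ℕP
  open import Data.Integer as ℤ using (ℤ; +_; +[1+_]; 0ℤ; ∣_∣)
  import Data.Integer.Properties as ℤP
  open import Data.Rational as ℚ using (ℚ; mkℚ; toℚᵘ; ↥_; ↧_; ↧ₙ_)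
  import Data.Rational.Properties as ℚP
  open import Data.Rational.Unnormalised as ℚᵘ using (ℚᵘ; mkℚᵘ; _≃_; *≡*)
  import Data.Rational.Unnormalised.Properties as ℚᵘP
  open import Data.Rational.Solver using (module +-*-Solver)
  open import Data.Fin using (Fin; zero; suc)
  open import Data.Product using (Σ; _×_; _,_; proj₁; proj₂)
  open import Relation.Binary.PropositionalEquality
  open ≡-Reasoning

  toℚᵘ-toℚ : ∀ z → toℚᵘ (toℚ z) ≃ mkℚᵘ z 0
  toℚᵘ-toℚ z = ℚP.toℚᵘ-fromℚᵘ (mkℚᵘ z 0)

  toℚ-injective : ∀ {x y} → toℚ x ≡ toℚ y → x ≡ y
  toℚ-injective {x} {y} eq with ℚᵘP.≃-trans (ℚᵘP.≃-sym (toℚᵘ-toℚ x))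
                                  (ℚᵘP.≃-trans (ℚP.toℚᵘ-cong eq) (toℚᵘ-toℚ y))
  ... | *≡* x*1≡y*1 = trans (sym (ℤP.*-identityʳ x)) (trans x*1≡y*1 (ℤP.*-identityʳ y))

  toℚ-* : ∀ x y → toℚ (x ℤ.* y) ≡ toℚ x ℚ.* toℚ y
  toℚ-* x y = ℚP.toℚᵘ-injective
    (ℚᵘP.≃-trans (toℚᵘ-toℚ (x ℤ.* y))
    (ℚᵘP.≃-trans (ℚᵘP.*-cong (ℚᵘP.≃-sym (toℚᵘ-toℚ x)) (ℚᵘP.≃-sym (toℚᵘ-toℚ y)))
                 (ℚᵘP.≃-sym (ℚP.toℚᵘ-homo-* (toℚ x) (toℚ y)))))

  toℚ-neg : ∀ x → toℚ (ℤ.- x) ≡ ℚ.- toℚ x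
  toℚ-neg x = ℚP.toℚᵘ-injective
    (ℚᵘP.≃-trans (toℚᵘ-toℚ (ℤ.- x))
    (ℚᵘP.≃-trans (ℚᵘP.-‿cong (ℚᵘP.≃-sym (toℚᵘ-toℚ x)))
                 (ℚᵘP.≃-sym (ℚP.toℚᵘ-homo‿- (toℚ x)))))

  S-spec : ∀ {n} (a : Fin n → ℤ) (nz : ∀ i → a i ≢ 0ℤ) l →
    S a nz l ℚ.* toℚ (a l) ≡ toℚ (a l ℤ.- sumℤ a)
  S-spec a nz l = begin
    ℚ.- (X ℚ.÷ Y) ℚ.* Y   ≡⟨ sym (ℚP.neg-distribˡ-* (X ℚ.÷ Y) Y) ⟩
    ℚ.- ((X ℚ.÷ Y) ℚ.* Y) ≡⟨ cong ℚ.-_ (trans (ℚP.*-assoc X (ℚ.1/ Y) Y)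
                              (trans (cong (X ℚ.*_) (ℚP.*-inverseˡ Y)) (ℚP.*-identityʳ X))) ⟩
    ℚ.- X                 ≡⟨ sym (toℚ-neg (sumℤ a ℤ.- a l)) ⟩
    toℚ (ℤ.- (sumℤ a ℤ.- a l)) ≡⟨ cong toℚ (negate-difference (sumℤ a) (a l)) ⟩
    toℚ (a l ℤ.- sumℤ a)  ∎
    where
    X = toℚ (sumℤ a ℤ.- a l)
    Y = toℚ (a l)
    instance
      Y≢0 : ℚ.NonZero Y
      Y≢0 = ℚ.≢-nonZero (toℚ-≢0 (nz l))
    negate-difference : ∀ s x → ℤ.- (s ℤ.- x) ≡ x ℤ.- s
    negate-difference s x = trans (ℤP.neg-distrib-+ s (ℤ.- x))
                                  (trans (cong (λ z → ℤ.- s ℤ.+ z) (ℤP.neg-involutive x)) (ℤP.+-comm (ℤ.- s) x))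

  scalarMultiple-from-cross : ∀ {n} (v a : Fin n → ℤ) r₀ → a r₀ ≢ 0ℤ →
    (∀ r → a r₀ ℤ.* v r ≡ a r ℤ.* v r₀) → ScalarMultiple v a
  scalarMultiple-from-cross v a r₀ a-r₀≢0 cross≡ = toℚ (v r₀) ℚ.* I , proportional
    where
    instance
      a-r₀≢0′ : ℚ.NonZero (toℚ (a r₀))
      a-r₀≢0′ = ℚ.≢-nonZero (toℚ-≢0 a-r₀≢0)
    I = ℚ.1/ toℚ (a r₀)
    proportional : ∀ i → toℚ (v i) ≡ (toℚ (v r₀) ℚ.* I) ℚ.* toℚ (a i)
    proportional i = begin
      toℚ (v i)                           ≡⟨ sym (trans (cong (toℚ (v i) ℚ.*_) (ℚP.*-inverseʳ (toℚ (a r₀))))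
                                                      (ℚP.*-identityʳ _)) ⟩
      toℚ (v i) ℚ.* (toℚ (a r₀) ℚ.* I)    ≡⟨ sym (ℚP.*-assoc (toℚ (v i)) (toℚ (a r₀)) I) ⟩
      (toℚ (v i) ℚ.* toℚ (a r₀)) ℚ.* I    ≡⟨ cong (ℚ._* I) (sym (toℚ-* (v i) (a r₀))) ⟩
      toℚ (v i ℤ.* a r₀) ℚ.* I            ≡⟨ cong (λ z → toℚ z ℚ.* I) (trans (ℤP.*-comm (v i) (a r₀)) (cross≡ i)) ⟩
      toℚ (a i ℤ.* v r₀) ℚ.* I            ≡⟨ cong (ℚ._* I) (toℚ-* (a i) (v r₀)) ⟩
      (toℚ (a i) ℚ.* toℚ (v r₀)) ℚ.* I    ≡⟨ ℚP.*-assoc (toℚ (a i)) (toℚ (v r₀)) I ⟩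
      toℚ (a i) ℚ.* (toℚ (v r₀) ℚ.* I)    ≡⟨ ℚP.*-comm (toℚ (a i)) (toℚ (v r₀) ℚ.* I) ⟩
      (toℚ (v r₀) ℚ.* I) ℚ.* toℚ (a i)    ∎

  product : ∀ {k} → (Fin k → ℕ) → ℕ
  product {zero}  f = 1
  product {suc k} f = f zero ℕ.* product (λ i → f (suc i))

  productExcept : ∀ {k} → (Fin k → ℕ) → Fin k → ℕ
  productExcept {suc k} f zero    = product (λ i → f (suc i))
  productExcept {suc k} f (suc t) = f zero ℕ.* productExcept (λ i → f (suc i)) t

  productExcept-spec : ∀ {k} (f : Fin k → ℕ) t → productExcept f t ℕ.* f t ≡ product f
  productExcept-spec {suc k} f zero    = ℕP.*-comm _ (f zero)
  productExcept-spec {suc k} f (suc t) =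
    trans (ℕP.*-assoc (f zero) _ _) (cong (f zero ℕ.*_) (productExcept-spec (λ i → f (suc i)) t))

  product-pos : ∀ {k} (f : Fin k → ℕ) → (∀ t → 1 ℕ.≤ f t) → 1 ℕ.≤ product f
  product-pos {zero}  f pos = s≤s z≤n
  product-pos {suc k} f pos = ℕP.*-mono-≤ (pos zero) (product-pos (λ i → f (suc i)) (λ i → pos (suc i)))

  productExcept-pos : ∀ {k} (f : Fin k → ℕ) → (∀ t → 1 ℕ.≤ f t) → ∀ t → 1 ℕ.≤ productExcept f t
  productExcept-pos {suc k} f pos zero    = product-pos (λ i → f (suc i)) (λ i → pos (suc i))
  productExcept-pos {suc k} f pos (suc t) =
    ℕP.*-mono-≤ (pos zero) (productExcept-pos (λ i → f (suc i)) (λ i → pos (suc i)) t)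

  positive-numerator : ∀ q → ℚ.Positive q → ↥ q ≡ + ∣ ↥ q ∣ × 1 ℕ.≤ ∣ ↥ q ∣
  positive-numerator (mkℚ +[1+ n ] _ _) _ = refl , s≤s z≤n

  clearDenominators : ∀ {k} (q : Fin k → ℚ) → (∀ t → ℚ.Positive (q t)) →
    Σ (Fin k → ℕ) λ e → Σ ℕ λ D → (∀ t → 1 ℕ.≤ e t) × (∀ t → toℚ (+ e t) ≡ q t ℚ.* toℚ (+ D))
  clearDenominators q pos = e , D , e-pos , e≡qD
    where
    denominators : _ → ℕ
    denominators t = ↧ₙ q t
    D = product denominators
    e : _ → ℕ
    e t = ∣ ↥ q t ∣ ℕ.* productExcept denominators t
    e-pos : ∀ t → 1 ℕ.≤ e t
    e-pos t = ℕP.*-mono-≤ (proj₂ (positive-numerator (q t) (pos t)))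
                          (productExcept-pos denominators (λ _ → s≤s z≤n) t)
    cross : ∀ t → + e t ℤ.* ↧ q t ≡ ↥ q t ℤ.* + D
    cross t = begin
      + e t ℤ.* + denominators t ≡⟨ sym (ℤP.pos-* (e t) (denominators t)) ⟩
      + (e t ℕ.* denominators t) ≡⟨ cong +_ (trans (ℕP.*-assoc ∣ ↥ q t ∣ _ _)
                                     (cong (∣ ↥ q t ∣ ℕ.*_) (productExcept-spec denominators t))) ⟩
      + (∣ ↥ q t ∣ ℕ.* D)        ≡⟨ ℤP.pos-* ∣ ↥ q t ∣ D ⟩
      + ∣ ↥ q t ∣ ℤ.* + D        ≡⟨ cong (ℤ._* + D) (sym (proj₁ (positive-numerator (q t) (pos t)))) ⟩
      ↥ q t ℤ.* + D              ∎
    e≡qD : ∀ t → toℚ (+ e t) ≡ q t ℚ.* toℚ (+ D)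
    e≡qD t = ℚP.toℚᵘ-injective
      (ℚᵘP.≃-trans (toℚᵘ-toℚ (+ e t))
      (ℚᵘP.≃-trans (fraction (q t) (e t) D (cross t))
      (ℚᵘP.≃-trans (ℚᵘP.*-cong (ℚᵘP.≃-refl {toℚᵘ (q t)}) (ℚᵘP.≃-sym (toℚᵘ-toℚ (+ D))))
                   (ℚᵘP.≃-sym (ℚP.toℚᵘ-homo-* (q t) (toℚ (+ D)))))))
      where
      fraction : ∀ p x y → + x ℤ.* ↧ p ≡ ↥ p ℤ.* + y → mkℚᵘ (+ x) 0 ≃ toℚᵘ p ℚᵘ.* mkℚᵘ (+ y) 0
      fraction (mkℚ n d _) x y h =
        *≡* (trans (cong (λ k → + x ℤ.* +[1+ k ]) (ℕP.*-identityʳ d)) (trans h (sym (ℤP.*-identityʳ _))))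

  ratio-to-integers : ∀ {q q′ s d x y e e′} → q ℚ.* s ≡ q′ → s ℚ.* toℚ x ≡ toℚ y →
    toℚ e ≡ q ℚ.* d → toℚ e′ ≡ q′ ℚ.* d → x ℤ.* e′ ≡ y ℤ.* e
  ratio-to-integers {q} {q′} {s} {d} {x} {y} {e} {e′} qs≡q′ sx≡y e≡qd e′≡q′d = toℚ-injective (begin
    toℚ (x ℤ.* e′)                   ≡⟨ toℚ-* x e′ ⟩
    toℚ x ℚ.* toℚ e′                 ≡⟨ cong (toℚ x ℚ.*_) (trans e′≡q′d (cong (ℚ._* d) (sym qs≡q′))) ⟩
    toℚ x ℚ.* ((q ℚ.* s) ℚ.* d)      ≡⟨ rearrange (toℚ x) q s d ⟩
    (s ℚ.* toℚ x) ℚ.* (q ℚ.* d)      ≡⟨ cong₂ ℚ._*_ sx≡y (sym e≡qd) ⟩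
    toℚ y ℚ.* toℚ e                  ≡⟨ sym (toℚ-* y e) ⟩
    toℚ (y ℤ.* e)                    ∎)
    where
    open +-*-Solver
    rearrange : ∀ X Q S D → X ℚ.* ((Q ℚ.* S) ℚ.* D) ≡ (S ℚ.* X) ℚ.* (Q ℚ.* D)
    rearrange = solve 4 (λ X Q S D → X :* ((Q :* S) :* D) := (S :* X) :* (Q :* D)) refl

module Balance where

  open import Defs
  open Linear
  open Rationals using (scalarMultiple-from-cross)
  open import Data.Nat as ℕ using (ℕ; suc)
  open import Data.Integer using (ℤ; +_; 0ℤ; 1ℤ; _+_; _*_; _-_)
  import Data.Integer.Properties as ℤP
  open import Data.Integer.Tactic.RingSolver using (solve-∀)
  open import Data.Fin using (Fin)
  open import Data.Fin.Properties using () renaming (_≟_ to _≟F_)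
  open import Data.Sum using (inj₁; inj₂; [_,_]′)
  open import Data.Empty using (⊥-elim)
  open import Function using (_∘_)
  open import Relation.Nullary using (Dec; yes; no)
  open import Relation.Binary.PropositionalEquality
  open ≡-Reasoning

  *-≢0 : ∀ {x y : ℤ} → x ≢ 0ℤ → y ≢ 0ℤ → x * y ≢ 0ℤ
  *-≢0 {x} x≢0 y≢0 xy≡0 = [ x≢0 , y≢0 ]′ (ℤP.i*j≡0⇒i≡0∨j≡0 x xy≡0)

  pos-≢0 : ∀ {x} → 1 ℕ.≤ x → + x ≢ 0ℤ
  pos-≢0 {suc x} _ ()

  -- Two weights eᵢ (everywhere) and eⱼ (at l).  When eⱼ / eᵢ = S l the weight
  -- vector W is orthogonal to a, and a row orthogonal to W and to the lattice of
  -- module Lattice is proportional to a.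
  module Weights {n} (a : Fin n → ℤ) (l : Fin n) (eᵢ eⱼ : ℕ) where

    weightAt : ∀ {r : Fin n} → Dec (r ≡ l) → ℕ
    weightAt (yes _) = eⱼ
    weightAt (no _)  = eᵢ

    weight : Fin n → ℕ
    weight r = weightAt (r ≟F l)

    weight-l : weight l ≡ eⱼ
    weight-l with l ≟F l
    ... | yes _   = refl
    ... | no l≢l = ⊥-elim (l≢l refl)

    W : Fin n → ℤ
    W r = + weight r

    balance : (Fin n → ℤ) → ℤ
    balance v = dot v W

    -- W = eᵢ · 1 + (eⱼ − eᵢ) · δ l
    balance-formula : ∀ v → balance v ≡ + eᵢ * sumℤ v + (+ eⱼ - + eᵢ) * v l
    balance-formula v = begin
      sumℤ (λ r → v r * W r)                                       ≡⟨ sum-cong (λ r → pointwise r (r ≟F l)) ⟩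
      sumℤ (λ r → + eᵢ * v r + (+ eⱼ - + eᵢ) * (v r * δ l r))      ≡⟨ sum-+ (λ r → + eᵢ * v r) (λ r → (+ eⱼ - + eᵢ) * (v r * δ l r)) ⟩
      sumℤ (λ r → + eᵢ * v r) + sumℤ (λ r → (+ eⱼ - + eᵢ) * (v r * δ l r))
        ≡⟨ cong₂ _+_ (sum-*ˡ (+ eᵢ) v) (trans (sum-*ˡ (+ eⱼ - + eᵢ) (λ r → v r * δ l r)) (cong ((+ eⱼ - + eᵢ) *_) (sum-δ v l))) ⟩
      + eᵢ * sumℤ v + (+ eⱼ - + eᵢ) * v l                          ∎
      where
      at-l : ∀ v ei ej → v * ej ≡ ei * v + (ej - ei) * (v * 1ℤ)
      at-l = solve-∀
      off-l : ∀ v ei ej → v * ei ≡ ei * v + (ej - ei) * (v * 0ℤ)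
      off-l = solve-∀
      pointwise : ∀ r (r≟l : Dec (r ≡ l)) → v r * + weightAt r≟l ≡ + eᵢ * v r + (+ eⱼ - + eᵢ) * (v r * δ l r)
      pointwise r (yes refl) rewrite δ-refl l = at-l (v l) (+ eᵢ) (+ eⱼ)
      pointwise r (no r≢l) rewrite δ-≢ l r (r≢l ∘ sym) = off-l (v r) (+ eᵢ) (+ eⱼ)

    balance-a : a l * + eⱼ ≡ (a l - sumℤ a) * + eᵢ → balance a ≡ 0ℤ
    balance-a ratio = trans (balance-formula a)
      (trans (rearrange (+ eᵢ) (+ eⱼ) (sumℤ a) (a l)) (ℤP.i≡j⇒i-j≡0 ratio))
      where
      rearrange : ∀ ei ej σ al → ei * σ + (ej - ei) * al ≡ al * ej - (al - σ) * ei
      rearrange = solve-∀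

    -- For v orthogonal to the lattice, w = a r₀ · v − v r₀ · a is supported
    -- at l, so balance w = eⱼ · w l; by linearity balance w = 0, hence w = 0.
    proportional-if-balanced : 1 ℕ.≤ eⱼ → balance a ≡ 0ℤ → ∀ r₀ → a r₀ ≢ 0ℤ → ∀ v → balance v ≡ 0ℤ →
      (∀ r → r ≢ l → dot v (cross a r₀ r) ≡ 0ℤ) → ScalarMultiple v a
    proportional-if-balanced 1≤eⱼ a-balanced r₀ a-r₀≢0 v v-balanced orthogonal =
      scalarMultiple-from-cross v a r₀ a-r₀≢0 (λ r → trans (ℤP.i-j≡0⇒i≡j _ _ (w≡0 r)) (ℤP.*-comm (v r₀) (a r)))
      where
      w : Fin n → ℤ
      w r = a r₀ * v r - v r₀ * a r
      w-off-l : ∀ r → r ≢ l → w r ≡ 0ℤ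
      w-off-l r r≢l = trans (cong (λ z → a r₀ * v r - z) (ℤP.*-comm (v r₀) (a r)))
                            (trans (sym (dot-cross a v r₀ r)) (orthogonal r r≢l))
      w-supported : ∀ r → w r ≡ w l * δ l r
      w-supported r with r ≟F l
      ... | yes refl = sym (trans (cong (w l *_) (δ-refl l)) (ℤP.*-identityʳ (w l)))
      ... | no r≢l   = trans (w-off-l r r≢l) (sym (trans (cong (w l *_) (δ-≢ l r (r≢l ∘ sym))) (ℤP.*-zeroʳ (w l))))
      swap : ∀ x c y → (x * c) * y ≡ (y * x) * c
      swap = solve-∀
      balance-w : balance w ≡ + eⱼ * w l
      balance-w = begin
        sumℤ (λ r → w r * W r)           ≡⟨ sum-cong (λ r → trans (cong (_* W r) (w-supported r)) (swap (w l) (δ l r) (W r))) ⟩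
        sumℤ (λ r → (W r * w l) * δ l r) ≡⟨ sum-δ (λ r → W r * w l) l ⟩
        W l * w l                        ≡⟨ cong (λ e → + e * w l) weight-l ⟩
        + eⱼ * w l                       ∎
      vanish : ∀ x y → x * 0ℤ - y * 0ℤ ≡ 0ℤ
      vanish = solve-∀
      balance-w≡0 : balance w ≡ 0ℤ
      balance-w≡0 = trans (dot-lincomb (a r₀) (v r₀) v a W)
        (trans (cong₂ (λ p q → a r₀ * p - v r₀ * q) v-balanced a-balanced) (vanish (a r₀) (v r₀)))
      w-l≡0 : w l ≡ 0ℤ
      w-l≡0 with ℤP.i*j≡0⇒i≡0∨j≡0 (+ eⱼ) (trans (sym balance-w) balance-w≡0)
      ... | inj₁ eⱼ≡0 = ⊥-elim (pos-≢0 1≤eⱼ eⱼ≡0)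
      ... | inj₂ w-l≡0 = w-l≡0
      w≡0 : ∀ r → w r ≡ 0ℤ
      w≡0 r = trans (w-supported r) (trans (cong (_* δ l r) w-l≡0) (ℤP.*-zeroˡ (δ l r)))

    lin-weighted : ∀ v (u : Fin n → ℤ) → u l ≡ 0ℤ → ∀ Z D (x : Fin n → ℕ) →
      (∀ r → + x r ≡ W r * (Z + u r * D)) → lin v x ≡ Z * balance v + (D * + eᵢ) * dot v u
    lin-weighted v u u-l≡0 Z D x x≡ = begin
      sumℤ (λ r → v r * + x r)                                        ≡⟨ sum-cong pointwise ⟩
      sumℤ (λ r → Z * (v r * W r) + (D * + eᵢ) * (v r * u r))         ≡⟨ sum-+ (λ r → Z * (v r * W r)) (λ r → (D * + eᵢ) * (v r * u r)) ⟩
      sumℤ (λ r → Z * (v r * W r)) + sumℤ (λ r → (D * + eᵢ) * (v r * u r))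
        ≡⟨ cong₂ _+_ (sum-*ˡ Z (λ r → v r * W r)) (sum-*ˡ (D * + eᵢ) (λ r → v r * u r)) ⟩
      Z * balance v + (D * + eᵢ) * dot v u                            ∎
      where
      -- on the support of u every weight is eᵢ
      W*u : ∀ r → W r * u r ≡ + eᵢ * u r
      W*u r with r ≟F l
      ... | yes refl rewrite u-l≡0 = trans (ℤP.*-zeroʳ (+ eⱼ)) (sym (ℤP.*-zeroʳ (+ eᵢ)))
      ... | no _ = refl
      expand : ∀ v c Z u D → v * (c * (Z + u * D)) ≡ Z * (v * c) + D * (v * (c * u))
      expand = solve-∀
      regroup : ∀ D e v u → D * (v * (e * u)) ≡ (D * e) * (v * u)
      regroup = solve-∀
      pointwise : ∀ r → v r * + x r ≡ Z * (v r * W r) + (D * + eᵢ) * (v r * u r)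
      pointwise r = begin
        v r * + x r                                         ≡⟨ cong (v r *_) (x≡ r) ⟩
        v r * (W r * (Z + u r * D))                         ≡⟨ expand (v r) (W r) Z (u r) D ⟩
        Z * (v r * W r) + D * (v r * (W r * u r))           ≡⟨ cong (λ p → Z * (v r * W r) + D * (v r * p)) (W*u r) ⟩
        Z * (v r * W r) + D * (v r * (+ eᵢ * u r))          ≡⟨ cong (λ q → Z * (v r * W r) + q) (regroup D (+ eᵢ) (v r) (u r)) ⟩
        Z * (v r * W r) + (D * + eᵢ) * (v r * u r)          ∎

module Construction where

  open import Defs
  open Linear
  open AffineRoots
  open Lattice
  open Balance
  open import Data.Nat as ℕ using (ℕ; suc; _∸_)
  import Data.Nat.Properties as ℕP
  open import Data.Integer as ℤ using (ℤ; +_; -[1+_]; 0ℤ; ∣_∣; _+_; _*_; _-_)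
  import Data.Integer.Properties as ℤP
  open import Data.Integer.Tactic.RingSolver using (solve-∀)
  open import Data.Fin using (Fin)
  open import Data.Product using (_,_; proj₁; proj₂)
  open import Data.Sum using (inj₁; inj₂)
  open import Data.Empty using (⊥-elim)
  open import Relation.Nullary using (¬_; yes; no)
  open import Relation.Nullary.Decidable using (decidable-stable)
  open import Relation.Binary.PropositionalEquality
  open ≡-Reasoning

  -- T + z as a natural number, for an integer z with ∣ z ∣ ≤ T.
  offsetBy : ℕ → ℤ → ℕ
  offsetBy T (+ p)    = T ℕ.+ p
  offsetBy T -[1+ p ] = T ∸ suc p

  offsetBy-spec : ∀ M t z → ∣ z ∣ ℕ.≤ M → + offsetBy (M ℕ.+ t) z ≡ + (M ℕ.+ t) + z
  offsetBy-spec M t (+ p)    _ = ℤP.pos-+ (M ℕ.+ t) p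
  offsetBy-spec M t -[1+ p ] b = sym (ℤP.⊖-≥ (ℕP.≤-trans b (ℕP.m≤m+n M t)))

  offsetBy-≤ : ∀ M t k z → t ℕ.≤ k → ∣ z ∣ ℕ.≤ M → offsetBy (M ℕ.+ t) z ℕ.≤ M ℕ.+ k ℕ.+ M
  offsetBy-≤ M t k (+ p)    t≤k b = ℕP.+-mono-≤ (ℕP.+-monoʳ-≤ M t≤k) b
  offsetBy-≤ M t k -[1+ p ] t≤k b =
    ℕP.≤-trans (ℕP.m∸n≤m (M ℕ.+ t) (suc p)) (ℕP.≤-trans (ℕP.+-monoʳ-≤ M t≤k) (ℕP.m≤m+n _ M))

  pos-affine : ∀ b o d → + suc (b ℕ.+ o ℕ.* d) ≡ + suc b + + o * + d
  pos-affine b o d = trans (ℤP.pos-+ (suc b) (o ℕ.* d)) (cong (λ w → + suc b + w) (ℤP.pos-* o d))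

  -- Given weights eᵢ, eⱼ with eⱼ / eᵢ = S l, a lattice vector u
  -- avoiding the rows of A, and any a₀ and step d ≥ 1, some t ≤ k makes
  --   x r = weight r · (1 + a₀ + (M + t + u r) · d)
  -- a solution of a · x = 0 with A j · x ≠ 0 for every j.  Each x r is a weight
  -- times a term 1 + a₀ + o · d with 0 ≤ o ≤ 2M + k.
  module Solution {n} (a : Fin n → ℤ) (l r₀ : Fin n) (r₀≢l : r₀ ≢ l) (a-r₀≢0 : a r₀ ≢ 0ℤ)
    (eᵢ eⱼ : ℕ) (1≤eᵢ : 1 ℕ.≤ eᵢ) (1≤eⱼ : 1 ℕ.≤ eⱼ) (ratio : a l * + eⱼ ≡ (a l - sumℤ a) * + eᵢ)
    {k} (A : Fin k → Fin n → ℤ) (nonMultiple : ∀ j → ¬ ScalarMultiple (A j) a)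
    (u : Fin n → ℤ) (avoiding : AuxiliaryVector.Avoiding a l r₀ r₀≢l A u)
    (M : ℕ) (bound : ∀ r → ∣ u r ∣ ℕ.≤ M) (a₀ d : ℕ) (1≤d : 1 ℕ.≤ d) where

    open Weights a l eᵢ eⱼ
    open AuxiliaryVector a l r₀ r₀≢l using (seesLattice?)

    a·u≡0 = proj₁ avoiding
    u-l≡0 = proj₁ (proj₂ avoiding)
    rows-avoid = proj₂ (proj₂ avoiding)

    C D : ℤ
    C = + suc (a₀ ℕ.+ M ℕ.* d)
    D = + d

    -- A j · x, as an affine function of t
    P Q : Fin k → ℤ
    P j = balance (A j) * D
    Q j = balance (A j) * C + D * + eᵢ * dot (A j) u

    -- No row gives the zero function: a balanced row is either seen by the
    -- lattice, and then u detects it, or it is a multiple of a.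
    nonTrivial : ∀ j → NonTrivial (P j) (Q j)
    nonTrivial j with balance (A j) ℤ.≟ 0ℤ
    ... | no unbalanced = inj₁ (*-≢0 unbalanced (pos-≢0 1≤d))
    ... | yes balanced with seesLattice? (A j)
    ...   | yes sees = inj₂ (λ Q≡0 → *-≢0 (*-≢0 (pos-≢0 1≤d) (pos-≢0 1≤eᵢ)) (rows-avoid j sees)
                            (trans (sym Q≡uterm) Q≡0))
      where
      Q≡uterm : Q j ≡ D * + eᵢ * dot (A j) u
      Q≡uterm = trans (cong (λ β → β * C + D * + eᵢ * dot (A j) u) balanced)
                      (trans (cong (_+ D * + eᵢ * dot (A j) u) (ℤP.*-zeroˡ C)) (ℤP.+-identityˡ _))
    ...   | no ¬sees = ⊥-elim (nonMultiple j (proportional-if-balanced 1≤eⱼ (balance-a ratio) r₀ a-r₀≢0 (A j) balanced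
                         (λ r r≢l → decidable-stable (dot (A j) (cross a r₀ r) ℤ.≟ 0ℤ)
                                                     (λ ≢0 → ¬sees (r , r≢l , ≢0)))))

    choice = avoidRoots k P Q
    t : ℕ
    t = proj₁ choice

    offset : Fin n → ℕ
    offset r = offsetBy (M ℕ.+ t) (u r)

    offset-≤ : ∀ r → offset r ℕ.≤ M ℕ.+ k ℕ.+ M
    offset-≤ r = offsetBy-≤ M t k (u r) (proj₁ (proj₂ choice)) (bound r)

    x : Fin n → ℕ
    x r = weight r ℕ.* suc (a₀ ℕ.+ offset r ℕ.* d)

    Z : ℤ
    Z = C + + t * D

    x≡ : ∀ r → + x r ≡ + weight r * (Z + u r * D)
    x≡ r = trans (ℤP.pos-* (weight r) _) (cong (+ weight r *_) (begin
      + suc (a₀ ℕ.+ offset r ℕ.* d)         ≡⟨ pos-affine a₀ (offset r) d ⟩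
      + suc a₀ + + offset r * D             ≡⟨ cong (λ o → + suc a₀ + o * D) (offsetBy-spec M t (u r) (bound r)) ⟩
      + suc a₀ + (+ (M ℕ.+ t) + u r) * D    ≡⟨ cong (λ s → + suc a₀ + (s + u r) * D) (ℤP.pos-+ M t) ⟩
      + suc a₀ + (+ M + + t + u r) * D      ≡⟨ regroup (+ suc a₀) (+ M) (+ t) (u r) D ⟩
      (+ suc a₀ + + M * D) + + t * D + u r * D ≡⟨ cong (λ c → c + + t * D + u r * D) (sym (pos-affine a₀ M d)) ⟩
      Z + u r * D                           ∎))
      where
      regroup : ∀ s M t u D → s + (M + t + u) * D ≡ (s + M * D) + t * D + u * D
      regroup = solve-∀

    solves : lin a x ≡ 0ℤ
    solves = trans (lin-weighted a u u-l≡0 Z D x x≡)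
      (trans (cong₂ (λ p q → Z * p + (D * + eᵢ) * q) (balance-a ratio) a·u≡0) (vanish Z (D * + eᵢ)))
      where
      vanish : ∀ x y → x * 0ℤ + y * 0ℤ ≡ 0ℤ
      vanish = solve-∀

    avoidsRows : ∀ j → lin (A j) x ≢ 0ℤ
    avoidsRows j Aj·x≡0 = proj₂ (proj₂ choice) j (nonTrivial j) (begin
      P j * + t + Q j  ≡⟨ sym (as-affine C (+ t) D (balance (A j)) (+ eᵢ) (dot (A j) u)) ⟩
      Z * balance (A j) + (D * + eᵢ) * dot (A j) u ≡⟨ sym (lin-weighted (A j) u u-l≡0 Z D x x≡) ⟩
      lin (A j) x      ≡⟨ Aj·x≡0 ⟩
      0ℤ               ∎)
      where
      as-affine : ∀ C t D β e γ → (C + t * D) * β + (D * e) * γ ≡ β * D * t + (β * C + D * e * γ)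
      as-affine = solve-∀

open import Defs
open import Data.Nat using (ℕ; suc; _≤_; _<_)
open import Data.Fin using (Fin)
open import Data.Integer using (ℤ; 0ℤ)
open import Data.Rational using (ℚ; 0ℚ; _*_; Positive)
open import Data.Product using (Σ; _×_)
open import Relation.Nullary using (¬_)
open import Relation.Binary.PropositionalEquality using (_≡_; _≢_)

open VanDerWaerden using (vanDerWaerden; encode; encode-injective)
open Lattice using (module AuxiliaryVector)
open Rationals using (clearDenominators; ratio-to-integers; S-spec)
open Balance using (*-≢0; pos-≢0; module Weights)
open Construction using (module Solution)
import Data.Nat as ℕ
open import Data.Nat using (zero; z≤n; s≤s; _^_)
import Data.Nat.Properties as ℕP
import Data.Integer as ℤ
open import Data.Integer using (+_; ∣_∣; _-_)
import Data.Integer.Properties as ℤP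
open import Data.Rational using (1ℚ)
import Data.Rational.Properties as ℚP
import Data.Fin as F
open import Data.Fin using (zero; suc; toℕ)
open import Data.Fin.Properties using (pigeonhole; toℕ<n; ¬Fin0) renaming (_≟_ to _≟F_)
open import Data.Product using (_,_; proj₁; proj₂)
open import Data.Empty using (⊥-elim)
open import Relation.Nullary using (Dec; yes; no)
open import Relation.Binary.PropositionalEquality using (sym; trans; cong)

RatioWeights : ∀ {n} → (Fin n → ℤ) → ℕ → Set
RatioWeights {n} a m = Σ (Fin (suc m) → ℕ) λ e → (∀ t → 1 ≤ e t) ×
  (∀ i j → i F.< j → Σ (Fin n) λ l → a l ℤ.* + e j ≡ (a l - sumℤ a) ℤ.* + e i)

sumℕ : ∀ {k} → (Fin k → ℕ) → ℕ
sumℕ {zero}  f = 0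
sumℕ {suc k} f = f zero ℕ.+ sumℕ (λ i → f (suc i))

sumℕ-≥ : ∀ {k} (f : Fin k → ℕ) i → f i ≤ sumℕ f
sumℕ-≥ f zero    = ℕP.m≤m+n _ _
sumℕ-≥ f (suc i) = ℕP.≤-trans (sumℕ-≥ (λ i → f (suc i)) i) (ℕP.m≤n+m _ (f zero))

commonBound : ∀ {n k} (U : Fin n → Fin k → ℤ) → Σ ℕ λ M → ∀ l r → ∣ U l r ∣ ≤ M
commonBound U = sumℕ size , λ l r → ℕP.≤-trans (sumℕ-≥ (λ r → ∣ U l r ∣) r) (sumℕ-≥ size l)
  where
  size : _ → ℕ
  size l = sumℕ (λ r → ∣ U l r ∣)

record ColourGrid {m} (χ : ℕ → Fin m) (e : Fin (suc m) → ℕ) (L : ℕ) : Set where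
  field
    a₀ d     : ℕ
    1≤d      : 1 ≤ d
    i j      : Fin (suc m)
    i<j      : i F.< j
    constant : ∀ o → o ≤ L → ∀ t → χ (e t ℕ.* suc (a₀ ℕ.+ o ℕ.* d)) ≡ χ (e t ℕ.* suc a₀)
    collide  : χ (e i ℕ.* suc a₀) ≡ χ (e j ℕ.* suc a₀)

-- Van der Waerden for the colouring v ↦ (χ (e t · v))ₜ, then pigeonhole.
colourGrid : ∀ {m} (χ : ℕ → Fin m) e L → ColourGrid χ e L
colourGrid {m} χ e L with proj₂ (vanDerWaerden L (m ^ suc m)) (λ v → encode (suc m) (λ t → χ (e t ℕ.* suc v)))
... | a₀ , d , 1≤d , _ , _ , sameTuple with pigeonhole (ℕP.n<1+n m) (λ t → χ (e t ℕ.* suc a₀))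
...   | i , j , i<j , collide = record
  { a₀ = a₀ ; d = d ; 1≤d = 1≤d ; i = i ; j = j ; i<j = i<j ; collide = collide
  ; constant = λ o o≤L → encode-injective (suc m) _ _ (sameTuple o o≤L) }

-- Take lattice vectors u for all l, bounded by M, and a colour grid of length
-- 2M + k.  Its colliding weights e i, e j have ratio some S l; the solution
-- built from them and u for this l lies on the grid, so it is monochromatic.
stronglyRegular-with-partners : ∀ {n} (a : Fin n → ℤ) (nz : ∀ i → a i ≢ 0ℤ) m → RatioWeights a m →
  (r₀ : Fin n → Fin n) → (∀ l → r₀ l ≢ l) → StronglyRegular m a
stronglyRegular-with-partners {n} a nz m (e , 1≤e , ratios) r₀ r₀≢ k A nonMultiple χ =
  x , positive , (λ r r′ → trans (colour r (r ≟F l)) (sym (colour r′ (r′ ≟F l)))) , solves , avoidsRows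
  where
  U : ∀ l → Σ (Fin n → ℤ) (AuxiliaryVector.Avoiding a l (r₀ l) (r₀≢ l) A)
  U l = AuxiliaryVector.auxiliaryVector a l (r₀ l) (r₀≢ l) k A
  bound = commonBound (λ l → proj₁ (U l))
  M = proj₁ bound
  open ColourGrid (colourGrid χ e (M ℕ.+ k ℕ.+ M))
  l = proj₁ (ratios i j i<j)
  open Solution a l (r₀ l) (r₀≢ l) (nz (r₀ l)) (e i) (e j) (1≤e i) (1≤e j) (proj₂ (ratios i j i<j))
                A nonMultiple (proj₁ (U l)) (proj₂ (U l)) M (proj₂ bound l) a₀ d 1≤d
  open Weights a l (e i) (e j) using (weightAt)
  positive : ∀ r → 1 ≤ x r
  positive r = ℕP.*-mono-≤ (weight-pos (r ≟F l)) (s≤s z≤n)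
    where
    weight-pos : ∀ {r} (r≟l : Dec (r ≡ l)) → 1 ≤ weightAt r≟l
    weight-pos (yes _) = 1≤e j
    weight-pos (no _)  = 1≤e i
  colour : ∀ r (r≟l : Dec (r ≡ l)) → χ (weightAt r≟l ℕ.* suc (a₀ ℕ.+ offset r ℕ.* d)) ≡ χ (e i ℕ.* suc a₀)
  colour r (yes _) = trans (constant (offset r) (offset-≤ r) j) (sym collide)
  colour r (no _)  = constant (offset r) (offset-≤ r) i

-- With at least two colours the ratios force at least two unknowns, so every
-- coordinate l has a partner r₀ l ≢ l.
stronglyRegular-from-weights : ∀ {n} (a : Fin n → ℤ) (nz : ∀ i → a i ≢ 0ℤ) m →
  RatioWeights a (suc m) → StronglyRegular (suc m) a
stronglyRegular-from-weights {zero} a nz m (e , 1≤e , ratios) with ratios zero (suc zero) (s≤s z≤n)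
... | () , _
stronglyRegular-from-weights {suc zero} a nz m (e , 1≤e , ratios) with ratios zero (suc zero) (s≤s z≤n)
... | zero , a₀e₁≡0 = ⊥-elim (*-≢0 (nz zero) (pos-≢0 (1≤e (suc zero)))
  (trans a₀e₁≡0 (trans (cong (ℤ._* + e zero) (a-[a+0]≡0 (a zero))) (ℤP.*-zeroˡ (+ e zero)))))
  where
  a-[a+0]≡0 : ∀ x → x - (x ℤ.+ 0ℤ) ≡ 0ℤ
  a-[a+0]≡0 x = trans (cong (x -_) (ℤP.+-identityʳ x)) (ℤP.+-inverseʳ x)
stronglyRegular-from-weights {suc (suc n)} a nz m weights =
  stronglyRegular-with-partners a nz (suc m) weights partner partner≢
  where
  partner : Fin (suc (suc n)) → Fin (suc (suc n))
  partner zero    = suc zero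
  partner (suc _) = zero
  partner≢ : ∀ l → partner l ≢ l
  partner≢ zero    ()
  partner≢ (suc _) ()

weights-from-ratios : ∀ {n} (a : Fin n → ℤ) (nz : ∀ i → a i ≢ 0ℤ) m (q : Fin (suc m) → ℚ) →
  (∀ t → Positive (q t)) → (∀ i j → i F.< j → Σ (Fin n) λ l → q i * S a nz l ≡ q j) → RatioWeights a m
weights-from-ratios {n} a nz m q positive ratios with clearDenominators q positive
... | e , D , 1≤e , e≡qD = e , 1≤e , integral
  where
  integral : ∀ i j → i F.< j → Σ (Fin n) λ l → a l ℤ.* + e j ≡ (a l - sumℤ a) ℤ.* + e i
  integral i j i<j with ratios i j i<j
  ... | l , qS≡q = l , ratio-to-integers {q i} {q j} {S a nz l} {toℚ (+ D)} {a l} {a l - sumℤ a} {+ e i} {+ e j}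
                           qS≡q (S-spec a nz l) (e≡qD i) (e≡qD j)

-- The linked matrix gives such rationals: q 0 = 1 and q t = c 1 t.  For i < j
-- the ratio is c 1 j = S l (i = 0) or c (i + 1) j = S l, by linkage.
ratios-from-matrix : ∀ {n} (a : Fin n → ℤ) (nz : ∀ i → a i ≢ 0ℤ) m (c : ℕ → ℕ → ℚ) →
  (∀ i j → 1 ≤ i → i ≤ j → j ≤ m → Positive (c i j) × Σ (Fin n) (λ l → c i j ≡ S a nz l)) →
  (∀ i j → 1 ≤ i → i < j → j ≤ m → c 1 i * c (suc i) j ≡ c 1 j) →
  Σ (Fin (suc m) → ℚ) λ q → (∀ t → Positive (q t)) × (∀ i j → i F.< j → Σ (Fin n) λ l → q i * S a nz l ≡ q j)
ratios-from-matrix {n} a nz m c entries linkage = q , positive , ratio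
  where
  q : Fin (suc m) → ℚ
  q zero    = 1ℚ
  q (suc t) = c 1 (suc (toℕ t))
  positive : ∀ t → Positive (q t)
  positive zero    = _
  positive (suc t) = proj₁ (entries 1 (suc (toℕ t)) ℕP.≤-refl (s≤s z≤n) (toℕ<n t))
  ratio : ∀ i j → i F.< j → Σ (Fin n) λ l → q i * S a nz l ≡ q j
  ratio zero (suc j) _ with entries 1 (suc (toℕ j)) ℕP.≤-refl (s≤s z≤n) (toℕ<n j)
  ... | _ , l , c≡S = l , trans (ℚP.*-identityˡ (S a nz l)) (sym c≡S)
  ratio (suc i) (suc j) i<j with entries (suc (suc (toℕ i))) (suc (toℕ j)) (s≤s z≤n) i<j (toℕ<n j)
  ... | _ , l , c≡S = l , trans (cong (q (suc i) *_) (sym c≡S))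
                                (linkage (suc (toℕ i)) (suc (toℕ j)) (s≤s z≤n) i<j (toℕ<n j))

stronglyRegular-zero : ∀ {n} (a : Fin n → ℤ) → StronglyRegular 0 a
stronglyRegular-zero a k A _ χ = ⊥-elim (¬Fin0 (χ 0))

-- The theorem.
theorem3 : (n : ℕ) (a : Fin n → ℤ) (nz : ∀ i → a i ≢ 0ℤ)
    (k : ℕ) (A : Fin k → Fin n → ℤ) → (∀ j → ¬ ScalarMultiple (A j) a) →
    (m : ℕ) (c : ℕ → ℕ → ℚ) →
    (∀ i j → 1 ≤ j → j < i → i ≤ m → c i j ≡ 0ℚ) →
    (∀ i j → 1 ≤ i → i ≤ j → j ≤ m →
      Positive (c i j) × Σ (Fin n) (λ l → c i j ≡ S a nz l)) →
    (∀ i j → 1 ≤ i → i < j → j ≤ m → c 1 i * c (suc i) j ≡ c 1 j) →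
    StronglyRegular m a × Regular m a A
theorem3 n a nz k A nonMultiple zero c _ _ _ =
  stronglyRegular-zero a , stronglyRegular-zero a k A nonMultiple
theorem3 n a nz k A nonMultiple (suc m) c _ entries linkage = strong , strong k A nonMultiple
  where
  q = ratios-from-matrix a nz (suc m) c entries linkage
  strong : StronglyRegular (suc m) a
  strong = stronglyRegular-from-weights a nz m
             (weights-from-ratios a nz (suc m) (proj₁ q) (proj₁ (proj₂ q)) (proj₂ (proj₂ q)))
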